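{- If $s_1\,R_\pi\,s_2$, then $[s_1s_2]=1$.
   Context: Let $G=(V,I)$ be an undirected graph ($I$ symmetric, self-loops allowed); $\mathrm{Ops}=\{o^+,o^-\mid o\in V\}$; $\cong$ the smallest congruence on $\mathrm{Ops}^*$ with $o_1^{\pm}o_2^{\pm}\cong o_2^{\pm}o_1^{\pm}$ for $o_1\,I\,o_2$ and $o^+o^-\cong\varepsilon$; $[w]$ the class of $w$, $1=[\varepsilon]$. A set of symbols is dependent if it contains no two distinct independent symbols; a word is dependent if its set of symbols is. Context decomposition of $w\in\mathrm{Ops}^+$: if $w$ is dependent it is one context; else the first context is the maximal dependent prefix, followed by the context decomposition of the rest. A reduction of a word is a finite sequence of applications of the rules (R1) delete an adjacent factor $o^+o^-$; (R2) delete an adjacent factor $o^-o^+$ if $o\,I\,o$; (R3) swap adjacent letters $a\in\{o_1^\pm\}$, $b\in\{o_2^\pm\}$ if $o_1\,I\,o_2$, $o_1\ne o_2$; transforming it into $\varepsilon$. Setting: $w\in\mathrm{Ops}^*$ of length $n$ with $[w]=1$ and context decomposition $w=w_1\cdots w_k$; letters of $w$ are annotated by their positions (kept under rewriting). Fix a reduction $\pi$ of $w$. For letters $x,y$, $x\,R_\pi\,y$ if $\pi$ deletes $x$ and $y$ together in one application of (R1) or (R2). Inductively, for infixes of contexts, $t_1s_1\,R_\pi\,s_2t_2$ if there are contexts $w_i=w_{i1}t_1s_1w_{i2}$ and $w_j=w_{j1}s_2t_2w_{j2}$ with $s_1\,R_\pi\,s_2$ and $t_1\,R_\pi\,t_2$.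 $R_\pi$ is symmetric; writing $s_1\,R_\pi\,s_2$ presumes that $s_1$ occurs before $s_2$ in $w$. -}

module Defs where

open import Data.Nat using (ℕ; suc; _<_)
open import Data.List using (List; []; _∷_; _++_; map; length)
open import Data.List.Membership.Propositional using (_∈_)
open import Data.Product using (Σ; _×_; _,_; proj₁; proj₂; ∃)
open import Relation.Binary.PropositionalEquality using (_≡_; _≢_)
open import Relation.Nullary using (¬_)
open import Data.Sum using (_⊎_)

data Pol : Set where
  pos neg : Pol

Op : Set → Set
Op V = V × Pol

var : {V : Set} → Op V → V
var = proj₁

ALetter : Set → Set
ALetter V = ℕ × Op V

position : {V : Set} → ALetter V → ℕ
position = proj₁

sym' : {V : Set} → ALetter V → Op V
sym' = proj₂

annotateFrom : {V : Set} → ℕ → List (Op V) → List (ALetter V)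
annotateFrom k []      = []
annotateFrom k (a ∷ w) = (k , a) ∷ annotateFrom (suc k) w

annotate : {V : Set} → List (Op V) → List (ALetter V)
annotate = annotateFrom 0

Infix : {A : Set} → List A → List A → Set
Infix {A} s c = Σ (List A) λ a → Σ (List A) λ b → c ≡ a ++ s ++ b

module _ {V : Set} (I : V → V → Set) where

  data Gen : List (Op V) → List (Op V) → Set where
    gen-swap : ∀ o₁ p₁ o₂ p₂ → I o₁ o₂ →
               Gen ((o₁ , p₁) ∷ (o₂ , p₂) ∷ []) ((o₂ , p₂) ∷ (o₁ , p₁) ∷ [])
    gen-cancel : ∀ o → Gen ((o , pos) ∷ (o , neg) ∷ []) []

  -- ≅ : the smallest congruence on Ops* containing Gen
  -- (= equivalence closure of Gen applied inside arbitrary contexts)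
  data _≅_ : List (Op V) → List (Op V) → Set where
    ≅-refl  : ∀ {u} → u ≅ u
    ≅-sym   : ∀ {u v} → u ≅ v → v ≅ u
    ≅-trans : ∀ {u v x} → u ≅ v → v ≅ x → u ≅ x
    ≅-gen   : ∀ u v {x y} → Gen x y → (u ++ x ++ v) ≅ (u ++ y ++ v)

  IsOne : List (Op V) → Set
  IsOne w = w ≅ []

  Dependent : List (ALetter V) → Set
  Dependent w = ∀ a b → a ∈ map sym' w → b ∈ map sym' w → a ≢ b → ¬ I (var a) (var b)

  data Decomp : List (ALetter V) → List (List (ALetter V)) → Set where
    dec-nil   : Decomp [] []
    dec-dep   : ∀ {w} → w ≢ [] → Dependent w → Decomp w (w ∷ [])
    dec-split : ∀ {c r cs} → ¬ Dependent (c ++ r) →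
                Dependent c →
                -- c is the maximal dependent prefix of c ++ r
                (∀ p q → c ++ r ≡ p ++ q → length c < length p → ¬ Dependent p) →
                Decomp r cs → Decomp (c ++ r) (c ∷ cs)

  data Reduction : List (ALetter V) → Set where
    done : Reduction []
    r1   : ∀ u v i j o → Reduction (u ++ v) →
           Reduction (u ++ (i , (o , pos)) ∷ (j , (o , neg)) ∷ v)
    r2   : ∀ u v i j o → I o o → Reduction (u ++ v) →
           Reduction (u ++ (i , (o , neg)) ∷ (j , (o , pos)) ∷ v)
    r3   : ∀ u v (a b : ALetter V) → I (var (sym' a)) (var (sym' b)) →
           var (sym' a) ≢ var (sym' b) →
           Reduction (u ++ b ∷ a ∷ v) → Reduction (u ++ a ∷ b ∷ v)

  data DeletedTogether : ∀ {w} → Reduction w → ALetter V → ALetter V → Set where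
    here₁  : ∀ {u v i j o π} →
             DeletedTogether (r1 u v i j o π) (i , (o , pos)) (j , (o , neg))
    here₂  : ∀ {u v i j o oo π} →
             DeletedTogether (r2 u v i j o oo π) (i , (o , neg)) (j , (o , pos))
    later₁ : ∀ {u v i j o π x y} → DeletedTogether π x y →
             DeletedTogether (r1 u v i j o π) x y
    later₂ : ∀ {u v i j o oo π x y} → DeletedTogether π x y →
             DeletedTogether (r2 u v i j o oo π) x y
    later₃ : ∀ {u v a b ab ne π x y} → DeletedTogether π x y →
             DeletedTogether (r3 u v a b ab ne π) x y

  InContext : List (List (ALetter V)) → List (ALetter V) → Set
  InContext cs s = Σ (List (ALetter V)) λ c → c ∈ cs × Infix s c

  -- R cs π s₁ s₂ : s₁ R_π s₂ with s₁ occurring before s₂ in w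
  -- (the oriented version; R_π itself is its symmetric closure)
  data R (cs : List (List (ALetter V))) {w} (π : Reduction w) :
         List (ALetter V) → List (ALetter V) → Set where
    R-base : ∀ x y → position x < position y →
             DeletedTogether π x y ⊎ DeletedTogether π y x →
             R cs π (x ∷ []) (y ∷ [])
    R-step : ∀ t₁ s₁ s₂ t₂ → R cs π s₁ s₂ → R cs π t₁ t₂ →
             InContext cs (t₁ ++ s₁) → InContext cs (s₂ ++ t₂) →
             R cs π (t₁ ++ s₁) (s₂ ++ t₂)

module Submission where

-- Rule (R3) only swaps letters of DISTINCT variables and
-- (R1)/(R2) only delete letters, so a reduction never changes the relative
-- order of two letters over the same variable.  In the annotated word the
-- order of letters is the order of their positions; hence when (R1)
-- deletes an adjacent factor x y = o⁺o⁻, we have position x < position y.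
-- Consequently a base pair x R_π y (position x < position y) reads
-- o⁺o⁻, or o⁻o⁺ with o I o, and both are ≅ ε.  The inductive step
-- t₁s₁ R_π s₂t₂ follows from the congruence fact
-- "[s] = 1 and [t₁t₂] = 1 imply [t₁ s t₂] = 1".

open import Defs
open import Data.List using (List; []; _∷_; _++_; map)
open import Data.List.Properties using (++-assoc; map-++)
open import Data.List.Membership.Propositional using (_∈_)
open import Data.List.Relation.Unary.Any using (here; there)
open import Data.Nat using (suc; _<_; _≤_)
open import Data.Nat.Properties using (<-asym; ≤-refl; ≤-trans; n≤1+n)
open import Data.Product using (_×_; _,_)
open import Data.Sum using (_⊎_; inj₁; inj₂)
open import Data.Empty using (⊥-elim)
open import Relation.Binary.Definitions using (Symmetric)
open import Relation.Binary.PropositionalEquality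
  using (_≡_; _≢_; refl; sym; cong; subst; subst₂; module ≡-Reasoning)

module _ {A : Set} where

  data Before (x y : A) : List A → Set where
    before-here  : ∀ {l} → y ∈ l → Before x y (x ∷ l)
    before-there : ∀ {z l} → Before x y l → Before x y (z ∷ l)

  ∈-insert : ∀ (u : List A) {v a b y} → y ∈ u ++ v → y ∈ u ++ a ∷ b ∷ v
  ∈-insert []      m         = there (there m)
  ∈-insert (c ∷ u) (here e)  = here e
  ∈-insert (c ∷ u) (there m) = there (∈-insert u m)

  before-insert : ∀ (u : List A) {v a b x y} →
                  Before x y (u ++ v) → Before x y (u ++ a ∷ b ∷ v)
  before-insert []      bf                = before-there (before-there bf)
  before-insert (c ∷ u) (before-here m)   = before-here (∈-insert u m)
  before-insert (c ∷ u) (before-there bf) = before-there (before-insert u bf)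

  before-adjacent : ∀ (u : List A) {v x y} → Before x y (u ++ x ∷ y ∷ v)
  before-adjacent []      = before-here (here refl)
  before-adjacent (c ∷ u) = before-there (before-adjacent u)

  ∈-swap : ∀ (u : List A) {v a b y} → y ∈ u ++ b ∷ a ∷ v → y ∈ u ++ a ∷ b ∷ v
  ∈-swap []      (here e)          = there (here e)
  ∈-swap []      (there (here e))  = here e
  ∈-swap []      (there (there m)) = there (there m)
  ∈-swap (c ∷ u) (here e)          = here e
  ∈-swap (c ∷ u) (there m)         = there (∈-swap u m)

  before-swap : ∀ (u : List A) {v a b x y} → Before x y (u ++ b ∷ a ∷ v) →
                Before x y (u ++ a ∷ b ∷ v) ⊎ (x ≡ b × y ≡ a)
  before-swap []      (before-here (here e))          = inj₂ (refl , e)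
  before-swap []      (before-here (there m))         = inj₁ (before-there (before-here m))
  before-swap []      (before-there (before-here m))  = inj₁ (before-here (there m))
  before-swap []      (before-there (before-there bf)) = inj₁ (before-there (before-there bf))
  before-swap (c ∷ u) (before-here m)                 = inj₁ (before-here (∈-swap u m))
  before-swap (c ∷ u) (before-there bf) with before-swap u bf
  ... | inj₁ bf′ = inj₁ (before-there bf′)
  ... | inj₂ eqs = inj₂ eqs

module _ {V : Set} (I : V → V → Set) where

  infix 4 _≈_
  _≈_ : List (Op V) → List (Op V) → Set
  _≈_ = _≅_ I

  ≅-context : ∀ a b {u v} → u ≈ v → a ++ u ++ b ≈ a ++ v ++ b
  ≅-context a b ≅-refl        = ≅-refl
  ≅-context a b (≅-sym p)     = ≅-sym (≅-context a b p)
  ≅-context a b (≅-trans p q) = ≅-trans (≅-context a b p) (≅-context a b q)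
  ≅-context a b (≅-gen u v {x} {y} g) =
    subst₂ _≈_ (sym (regroup x)) (sym (regroup y)) (≅-gen (a ++ u) (v ++ b) g)
    where
    open ≡-Reasoning
    regroup : ∀ z → a ++ (u ++ z ++ v) ++ b ≡ (a ++ u) ++ z ++ (v ++ b)
    regroup z = begin
      a ++ (u ++ z ++ v) ++ b     ≡⟨ cong (a ++_) (++-assoc u (z ++ v) b) ⟩
      a ++ u ++ (z ++ v) ++ b     ≡⟨ cong (λ r → a ++ u ++ r) (++-assoc z v b) ⟩
      a ++ u ++ z ++ v ++ b       ≡⟨ sym (++-assoc a u (z ++ v ++ b)) ⟩
      (a ++ u) ++ z ++ (v ++ b)   ∎

  one-nested : ∀ t₁ s t₂ → IsOne I s → IsOne I (t₁ ++ t₂) → IsOne I (t₁ ++ s ++ t₂)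
  one-nested t₁ s t₂ s≈ε t≈ε = ≅-trans (≅-context t₁ t₂ s≈ε) t≈ε

  cancel-pos-neg : ∀ o → IsOne I ((o , pos) ∷ (o , neg) ∷ [])
  cancel-pos-neg o = ≅-gen [] [] (gen-cancel o)

  cancel-neg-pos : ∀ o → I o o → IsOne I ((o , neg) ∷ (o , pos) ∷ [])
  cancel-neg-pos o oIo = ≅-trans (≅-gen [] [] (gen-swap o neg o pos oIo)) (cancel-pos-neg o)

  SameVarOrdered : List (ALetter V) → Set
  SameVarOrdered w = ∀ x y → Before x y w → var (sym' x) ≡ var (sym' y) →
                     position x < position y

  ∈-annotate-position : ∀ k (w : List (Op V)) {y} → y ∈ annotateFrom k w → k ≤ position y
  ∈-annotate-position k (a ∷ w) (here refl) = ≤-refl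
  ∈-annotate-position k (a ∷ w) (there m)   =
    ≤-trans (n≤1+n k) (∈-annotate-position (suc k) w m)

  before-annotate-position : ∀ k (w : List (Op V)) {x y} →
                             Before x y (annotateFrom k w) → position x < position y
  before-annotate-position k (a ∷ w) (before-here m)   = ∈-annotate-position (suc k) w m
  before-annotate-position k (a ∷ w) (before-there bf) = before-annotate-position (suc k) w bf

  annotate-ordered : ∀ w → SameVarOrdered (annotate w)
  annotate-ordered w x y bf _ = before-annotate-position 0 w bf

  ordered-delete : ∀ u {v a b} → SameVarOrdered (u ++ a ∷ b ∷ v) → SameVarOrdered (u ++ v)
  ordered-delete u ord x y bf = ord x y (before-insert u bf)

  ordered-swap : ∀ u {v} (a b : ALetter V) → var (sym' a) ≢ var (sym' b) →
                 SameVarOrdered (u ++ a ∷ b ∷ v) → SameVarOrdered (u ++ b ∷ a ∷ v)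
  ordered-swap u a b a≢b ord x y bf same with before-swap u bf
  ... | inj₁ bf′        = ord x y bf′ same
  ... | inj₂ (refl , refl) = ⊥-elim (a≢b (sym same))

  data CancellingPair : ALetter V → ALetter V → Set where
    by-R1 : ∀ i j o → i < j → CancellingPair (i , (o , pos)) (j , (o , neg))
    by-R2 : ∀ i j o → I o o → CancellingPair (i , (o , neg)) (j , (o , pos))

  deleted-pair-shape : ∀ {w} {π : Reduction I w} {x y} → SameVarOrdered w →
                       DeletedTogether I π x y → CancellingPair x y
  deleted-pair-shape ord (here₁ {u} {i = i} {j} {o}) = by-R1 i j o (ord _ _ (before-adjacent u) refl)
  deleted-pair-shape ord (here₂ {i = i} {j} {o} {oIo}) = by-R2 i j o oIo
  deleted-pair-shape ord (later₁ {u} d) = deleted-pair-shape (ordered-delete u ord) d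
  deleted-pair-shape ord (later₂ {u} d) = deleted-pair-shape (ordered-delete u ord) d
  deleted-pair-shape ord (later₃ {u} {a = a} {b} {ne = ne} d) =
    deleted-pair-shape (ordered-swap u a b ne ord) d

  base-pair-one : ∀ {w} {π : Reduction I w} → SameVarOrdered w → ∀ x y →
                  position x < position y →
                  DeletedTogether I π x y ⊎ DeletedTogether I π y x →
                  IsOne I (sym' x ∷ sym' y ∷ [])
  base-pair-one ord x y _ (inj₁ d) with deleted-pair-shape ord d
  ... | by-R1 _ _ o _   = cancel-pos-neg o
  ... | by-R2 _ _ o oIo = cancel-neg-pos o oIo
  base-pair-one ord x y x<y (inj₂ d) with deleted-pair-shape ord d
  ... | by-R1 _ _ _ y<x = ⊥-elim (<-asym x<y y<x)
  ... | by-R2 _ _ o _   = cancel-pos-neg o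

  R-one : ∀ {w} {π : Reduction I w} {cs} → SameVarOrdered w →
          ∀ {s₁ s₂} → R I cs π s₁ s₂ → IsOne I (map sym' (s₁ ++ s₂))
  R-one ord (R-base x y x<y d) = base-pair-one ord x y x<y d
  R-one ord (R-step t₁ s₁ s₂ t₂ rs rt _ _) =
    subst (IsOne I) (sym split)
      (one-nested (map sym' t₁) (map sym' (s₁ ++ s₂)) (map sym' t₂)
        (R-one ord rs)
        (subst (IsOne I) (map-++ sym' t₁ t₂) (R-one ord rt)))
    where
    open ≡-Reasoning
    split : map sym' ((t₁ ++ s₁) ++ (s₂ ++ t₂))
          ≡ map sym' t₁ ++ map sym' (s₁ ++ s₂) ++ map sym' t₂
    split = begin
      map sym' ((t₁ ++ s₁) ++ (s₂ ++ t₂))    ≡⟨ cong (map sym') (++-assoc t₁ s₁ (s₂ ++ t₂)) ⟩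
      map sym' (t₁ ++ s₁ ++ s₂ ++ t₂)        ≡⟨ cong (λ r → map sym' (t₁ ++ r)) (sym (++-assoc s₁ s₂ t₂)) ⟩
      map sym' (t₁ ++ (s₁ ++ s₂) ++ t₂)      ≡⟨ map-++ sym' t₁ ((s₁ ++ s₂) ++ t₂) ⟩
      map sym' t₁ ++ map sym' ((s₁ ++ s₂) ++ t₂)
                                             ≡⟨ cong (map sym' t₁ ++_) (map-++ sym' (s₁ ++ s₂) t₂) ⟩
      map sym' t₁ ++ map sym' (s₁ ++ s₂) ++ map sym' t₂ ∎

-- Lemma 13: if s₁ R_π s₂ then [s₁s₂] = 1.
lemma13 : {V : Set} (I : V → V → Set) → Symmetric I →
          (w : List (Op V)) → IsOne I w →
          (cs : List (List (ALetter V))) → Decomp I (annotate w) cs →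
          (π : Reduction I (annotate w)) →
          (s₁ s₂ : List (ALetter V)) → R I cs π s₁ s₂ →
          IsOne I (map sym' (s₁ ++ s₂))
lemma13 I _ w _ cs _ π s₁ s₂ r = R-one I (annotate-ordered I w) r
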